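{- For a triangle-free graph $G$, the following are equivalent: (i) $G$ is $3$-colorable; (ii) $G$ is perfectly divisible; (iii) $G$ is stable-perfect; (iv) $G$ is nice.
   Context: All graphs are finite and simple; induced subgraphs are taken to have at least one vertex. For $X\subseteq V(G)$, $G[X]$ denotes the subgraph induced on $X$; $\chi$ denotes chromatic number and $\omega$ clique number (with $\omega$ of the graph with no vertices equal to $0$). A graph is perfect if $\chi(H)=\omega(H)$ for every induced subgraph $H$. A graph $G$ is perfectly divisible if for every induced subgraph $H$ of $G$, $V(H)$ can be partitioned into two sets $A,B$ (possibly empty) such that $H[A]$ is perfect and $\omega(H[B])<\omega(H)$. $G$ is stable-perfect if $G$ contains a stable set $S$ such that $G\setminus S$ is perfect. $G$ is nice if for every induced subgraph $H$ of $G$, $\chi(H)-\omega(H)\in\{0,1\}$. -}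

module Defs where

open import Data.Nat using (ℕ; _<_; _≤_; suc)
open import Data.Fin using (Fin)
open import Data.Fin.Subset using (Subset; _∈_; _∉_; _⊆_; Nonempty; ⊤; ∁)
open import Data.Bool using (Bool; true; false)
open import Data.Product using (Σ; ∃; _×_; _,_)
open import Data.Sum using (_⊎_)
open import Relation.Nullary using (¬_)
open import Data.Empty using (⊥)
open import Relation.Binary.PropositionalEquality using (_≡_; _≢_)

record Graph : Set where
  field
    n     : ℕ
    adj   : Fin n → Fin n → Bool
    sym   : ∀ u v → adj u v ≡ adj v u
    irrefl : ∀ v → adj v v ≡ false

module _ (G : Graph) where
  open Graph G

  Adj : Fin n → Fin n → Set
  Adj u v = adj u v ≡ true

  -- Induced subgraphs G[X] are represented by vertex subsets X ⊆ V(G).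

  Colorable : Subset n → ℕ → Set
  Colorable X k = Σ (Fin n → Fin k) λ c →
    ∀ u v → u ∈ X → v ∈ X → Adj u v → c u ≢ c v

  HasClique : Subset n → ℕ → Set
  HasClique X k = Σ (Fin k → Fin n) λ f →
    (∀ i → f i ∈ X) × (∀ i j → i ≢ j → Adj (f i) (f j))

  ChromaticNumber : Subset n → ℕ → Set
  ChromaticNumber X k = Colorable X k × (∀ j → Colorable X j → k ≤ j)

  -- ω(G[X]) = k  (ω of the empty graph is 0)
  CliqueNumber : Subset n → ℕ → Set
  CliqueNumber X k = HasClique X k × (∀ j → HasClique X j → j ≤ k)

  Perfect : Subset n → Set
  Perfect X = ∀ (Y : Subset n) → Y ⊆ X → Nonempty Y →
    ∃ λ k → ChromaticNumber Y k × CliqueNumber Y k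

  Stable : Subset n → Set
  Stable S = ∀ u v → u ∈ S → v ∈ S → ¬ Adj u v

  TriangleFree : Set
  TriangleFree = ∀ u v w → Adj u v → Adj v w → Adj u w → ⊥

  ThreeColorable : Set
  ThreeColorable = Colorable ⊤ 3

  IsPartition : Subset n → Subset n → Subset n → Set
  IsPartition H A B = A ⊆ H × B ⊆ H ×
    (∀ x → x ∈ H → x ∈ A ⊎ x ∈ B) × (∀ x → x ∈ A → x ∉ B)

  PerfectlyDivisible : Set
  PerfectlyDivisible = ∀ (H : Subset n) → Nonempty H →
    ∃ λ A → ∃ λ B → IsPartition H A B × Perfect A ×
      ∃ λ wB → ∃ λ wH → CliqueNumber B wB × CliqueNumber H wH × wB < wH

  StablePerfect : Set
  StablePerfect = ∃ λ S → Stable S ×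
    Perfect (∁ S)

  Nice : Set
  Nice = ∀ (H : Subset n) → Nonempty H →
    ∃ λ c → ∃ λ w → ChromaticNumber H c × CliqueNumber H w ×
      (c ≡ w ⊎ c ≡ suc w)

module Submission where

-- In a triangle-free graph every clique has at most two vertices, so the
-- clique number of G[Y] is 2, 1 or 0 according to whether Y spans an edge,
-- is a nonempty stable set, or is empty.  Two consequences drive the proof:
--   * G[A] is perfect iff it is 2-colourable;
--   * a set B with ω(G[B]) ≤ 1 is stable.
-- Independently of triangle-freeness, G is 3-colourable iff V(G) is covered
-- by a stable set S (one colour class) and a set A with G[A] 2-colourable.
-- A 3-colouring thus yields (iii) directly and (ii) by splitting each H along
-- a colour class; conversely (ii) and (iii) each supply such a pair (S, A).
-- For (iv), χ(H) exists by a finite search over colourings, and for H with an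
-- edge one has 2 = ω(H) ≤ χ(H) ≤ 3; conversely χ(G) ≤ ω(G) + 1 ≤ 3.
-- The file proves general facts on colourings and cliques of an arbitrary
-- graph, then the triangle-free facts, and finally the theorem.

open import Defs
open import Data.Nat using (zero; suc; _≤_; z≤n; s≤s; s≤s⁻¹)
open import Data.Nat.Properties using (≤-refl; ≤-trans; ≰⇒>; <⇒≱; m≤n⇒m≤1+n)
open import Data.Fin using (Fin; inject≤; inject₁; fromℕ) renaming (zero to fz; suc to fs; _≟_ to _≟F_)
open import Data.Fin.Properties using (any?; all?; inject≤-injective; inject₁-injective; fromℕ≢inject₁)
open import Data.Fin.Subset using (Subset; _∈_; _∉_; _⊆_; Nonempty; ⊤; ⊥; ∁; _∩_)
open import Data.Fin.Subset.Properties using (_∈?_; nonempty?; ∉⊥; ∈⊤; x∈p∩q⁺; x∈p∩q⁻; x∈∁p⇒x∉p; x∉p⇒x∈∁p)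
open import Data.Bool using (Bool; true) renaming (_≟_ to _≟B_)
open import Data.Product using (_×_; ∃; _,_; proj₁; proj₂)
open import Data.Sum using (_⊎_; inj₁; inj₂)
open import Data.Vec using (tabulate)
open import Data.Vec.Properties using ([]=⇒lookup; lookup⇒[]=; lookup∘tabulate)
open import Data.Vec.Functional using (_∷_; tail)
open import Relation.Nullary using (¬_; Dec; yes; no; does; contradiction)
open import Relation.Nullary.Decidable using (_→-dec_; ¬?; _×-dec_)
open import Relation.Binary.PropositionalEquality using (_≡_; _≢_; refl; sym; trans)
open import Function.Bundles using (_⇔_; mk⇔)

searchFunctions : ∀ m k (P : (Fin m → Fin k) → Set) →
  (∀ {f g} → (∀ i → f i ≡ g i) → P f → P g) →
  (∀ f → Dec (P f)) → Dec (∃ P)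
searchFunctions zero k P resp P? with P? (λ ())
... | yes p = yes (_ , p)
... | no ¬p = no λ (f , pf) → ¬p (resp (λ ()) pf)
searchFunctions (suc m) k P resp P?
  with any? (λ a → searchFunctions m k (λ f → P (a ∷ f))
         (λ f≗g → resp λ { fz → refl ; (fs i) → f≗g i }) (λ f → P? (a ∷ f)))
... | yes (a , f , p) = yes (a ∷ f , p)
... | no ¬q = no λ (f , pf) →
  ¬q (f fz , tail f , resp (λ { fz → refl ; (fs i) → refl }) pf)

-- The top colour of a 3-colouring; the other two colours are inject₁ of Fin 2.
top : Fin 3
top = fromℕ 2

-- Merge the top colour into colour 0: on the two non-top colours this map is
-- injective, which turns a 3-colouring minus a colour class into a 2-colouring.
dropTop : Fin 3 → Fin 2
dropTop fz = fz
dropTop (fs fz) = fs fz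
dropTop (fs (fs fz)) = fz

dropTop-injective : ∀ i j → i ≢ top → j ≢ top → dropTop i ≡ dropTop j → i ≡ j
dropTop-injective fz fz _ _ _ = refl
dropTop-injective (fs fz) (fs fz) _ _ _ = refl
dropTop-injective (fs (fs fz)) _ i≢top _ _ = contradiction refl i≢top
dropTop-injective _ (fs (fs fz)) _ j≢top _ = contradiction refl j≢top
dropTop-injective fz (fs fz) _ _ ()
dropTop-injective (fs fz) fz _ _ ()

twoOrThree : ∀ {c} → 2 ≤ c → c ≤ 3 → c ≡ 2 ⊎ c ≡ 3
twoOrThree {0} () _
twoOrThree {1} (s≤s ()) _
twoOrThree {2} _ _ = inj₁ refl
twoOrThree {3} _ _ = inj₂ refl
twoOrThree {suc (suc (suc (suc _)))} _ (s≤s (s≤s (s≤s ())))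

atMostOneMore : ∀ {c w} → c ≡ w ⊎ c ≡ suc w → w ≤ 2 → c ≤ 3
atMostOneMore (inj₁ refl) w≤2 = m≤n⇒m≤1+n w≤2
atMostOneMore (inj₂ refl) w≤2 = s≤s w≤2

module GraphFacts (G : Graph) where
  open Graph G using (n; adj)

  adj? : ∀ u v → Dec (Adj G u v)
  adj? u v = adj u v ≟B true

  adj-sym : ∀ {u v} → Adj G u v → Adj G v u
  adj-sym {u} {v} e = trans (Graph.sym G v u) e

  Edge : Subset n → Set
  Edge Y = ∃ λ u → ∃ λ v → u ∈ Y × v ∈ Y × Adj G u v

  edgeOrStable : ∀ Y → Edge Y ⊎ Stable G Y
  edgeOrStable Y with any? (λ u → any? λ v → (u ∈? Y) ×-dec (v ∈? Y) ×-dec adj? u v)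
  ... | yes e = inj₁ e
  ... | no ¬e = inj₂ λ u v u∈Y v∈Y e → ¬e (u , v , u∈Y , v∈Y , e)

  restrict : ∀ {X Y k} → Colorable G X k → Y ⊆ X → Colorable G Y k
  restrict (c , ok) Y⊆X = c , λ u v u∈Y v∈Y → ok u v (Y⊆X u∈Y) (Y⊆X v∈Y)

  moreColours : ∀ {X j k} → Colorable G X j → j ≤ k → Colorable G X k
  moreColours (c , ok) j≤k = (λ x → inject≤ (c x) j≤k) ,
    λ u v u∈X v∈X e eq → ok u v u∈X v∈X e (inject≤-injective j≤k j≤k _ _ eq)

  emptyColorable : ∀ {X k} → ¬ Nonempty X → Colorable G X (suc k)
  emptyColorable X≡∅ = (λ _ → fz) , λ u _ u∈X _ _ _ → X≡∅ (u , u∈X)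

  stableColorable : ∀ {X} → Stable G X → Colorable G X 1
  stableColorable st = (λ _ → fz) , λ u v u∈X v∈X e _ → st u v u∈X v∈X e

  vertexNeedsColour : ∀ {Y j} → Nonempty Y → Colorable G Y j → 1 ≤ j
  vertexNeedsColour {j = zero} (x , _) (c , _) with c x
  ... | ()
  vertexNeedsColour {j = suc j} _ _ = s≤s z≤n

  edgeNeedsTwoColours : ∀ {Y j} → Edge Y → Colorable G Y j → 2 ≤ j
  edgeNeedsTwoColours {j = zero} (u , _) (c , _) with c u
  ... | ()
  edgeNeedsTwoColours {j = suc zero} (u , v , u∈Y , v∈Y , e) (c , ok) with c u | c v | ok u v u∈Y v∈Y e
  ... | fz | fz | c-differs = contradiction refl c-differs
  edgeNeedsTwoColours {j = suc (suc j)} _ _ = s≤s (s≤s z≤n)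

  colorable? : ∀ Y k → Dec (Colorable G Y k)
  colorable? Y k = searchFunctions n k _
    (λ c≗d ok u v u∈Y v∈Y e eq → ok u v u∈Y v∈Y e (trans (c≗d u) (trans eq (sym (c≗d v)))))
    (λ c → all? λ u → all? λ v →
       (u ∈? Y) →-dec (v ∈? Y) →-dec adj? u v →-dec ¬? (c u ≟F c v))

  -- A k-colourable G[X] has a chromatic number χ ≤ k: if k - 1 colours
  -- do not suffice then χ = k, otherwise recurse.
  chromaticNumber : ∀ {X k} → Colorable G X k → ∃ λ χ → χ ≤ k × ChromaticNumber G X χ
  chromaticNumber {k = zero} c = 0 , z≤n , c , λ _ _ → z≤n
  chromaticNumber {X} {suc k} c with colorable? X k
  ... | yes ck = let χ , χ≤k , isχ = chromaticNumber ck in χ , m≤n⇒m≤1+n χ≤k , isχ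
  ... | no ¬ck = suc k , ≤-refl , c , λ j cj → ≰⇒> λ j≤k → ¬ck (moreColours cj j≤k)

  emptyClique : ∀ {Y} → HasClique G Y 0
  emptyClique = (λ ()) , (λ ()) , λ ()

  vertexClique : ∀ {Y} → Nonempty Y → HasClique G Y 1
  vertexClique (x , x∈Y) = (λ _ → x) , (λ _ → x∈Y) , λ { fz fz fz≢fz → contradiction refl fz≢fz }

  edgeClique : ∀ {Y} → Edge Y → HasClique G Y 2
  edgeClique {Y} (u , v , u∈Y , v∈Y , e) = ends , ends∈Y , adjacent
    where
      ends : Fin 2 → Fin n
      ends fz = u
      ends (fs _) = v
      ends∈Y : ∀ i → ends i ∈ Y
      ends∈Y fz = u∈Y
      ends∈Y (fs fz) = v∈Y
      adjacent : ∀ i j → i ≢ j → Adj G (ends i) (ends j)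
      adjacent fz fz i≢j = contradiction refl i≢j
      adjacent fz (fs fz) _ = e
      adjacent (fs fz) fz _ = adj-sym e
      adjacent (fs fz) (fs fz) i≢j = contradiction refl i≢j

  emptyHasNoClique : ∀ {Y j} → ¬ Nonempty Y → HasClique G Y j → j ≤ 0
  emptyHasNoClique {j = zero} _ _ = z≤n
  emptyHasNoClique {j = suc j} Y≡∅ (f , f∈Y , _) = contradiction (f fz , f∈Y fz) Y≡∅

  stableCliqueBound : ∀ {Y j} → Stable G Y → HasClique G Y j → j ≤ 1
  stableCliqueBound {j = zero} _ _ = z≤n
  stableCliqueBound {j = suc zero} _ _ = s≤s z≤n
  stableCliqueBound {j = suc (suc j)} st (f , f∈Y , clique) =
    contradiction (clique fz (fs fz) λ ()) (st (f fz) (f (fs fz)) (f∈Y fz) (f∈Y (fs fz)))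

  ω-empty : ∀ {Y} → ¬ Nonempty Y → CliqueNumber G Y 0
  ω-empty Y≡∅ = emptyClique , λ _ → emptyHasNoClique Y≡∅

  ω-stable : ∀ {Y} → Nonempty Y → Stable G Y → CliqueNumber G Y 1
  ω-stable x st = vertexClique x , λ _ → stableCliqueBound st

  ω-stable≤1 : ∀ {Y} → Stable G Y → ∃ λ w → w ≤ 1 × CliqueNumber G Y w
  ω-stable≤1 {Y} st with nonempty? Y
  ... | yes x = 1 , ≤-refl , ω-stable x st
  ... | no Y≡∅ = 0 , z≤n , ω-empty Y≡∅

  ω≤1⇒stable : ∀ {B w} → CliqueNumber G B w → w ≤ 1 → Stable G B
  ω≤1⇒stable (_ , maximal) w≤1 u v u∈B v∈B e =
    <⇒≱ (s≤s (s≤s z≤n)) (≤-trans (maximal 2 (edgeClique (u , v , u∈B , v∈B , e))) w≤1)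

  splitAlong : ∀ H S → IsPartition G H (H ∩ ∁ S) (H ∩ S)
  splitAlong H S =
    (λ x∈ → proj₁ (x∈p∩q⁻ H (∁ S) x∈)) , (λ x∈ → proj₁ (x∈p∩q⁻ H S x∈)) , cover ,
    λ x x∈H∖S x∈H∩S → x∈∁p⇒x∉p (proj₂ (x∈p∩q⁻ H (∁ S) x∈H∖S)) (proj₂ (x∈p∩q⁻ H S x∈H∩S))
    where
      cover : ∀ x → x ∈ H → x ∈ H ∩ ∁ S ⊎ x ∈ H ∩ S
      cover x x∈H with x ∈? S
      ... | yes x∈S = inj₂ (x∈p∩q⁺ (x∈H , x∈S))
      ... | no x∉S = inj₁ (x∈p∩q⁺ (x∈H , x∉p⇒x∈∁p x∉S))

  wholePartition : ∀ H → IsPartition G H H ⊥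
  wholePartition H = (λ x∈ → x∈) , (λ x∈⊥ → contradiction x∈⊥ ∉⊥) , (λ _ x∈ → inj₁ x∈) , λ _ _ → ∉⊥

  stable+bipartite⇒3colourable : ∀ S A → Stable G S → Colorable G A 2 →
    (∀ x → x ∈ A ⊎ x ∈ S) → ThreeColorable G
  stable+bipartite⇒3colourable S A st (d , d-ok) cover = c , c-ok
    where
      c : Fin n → Fin 3
      c x with x ∈? S
      ... | yes _ = top
      ... | no _ = inject₁ (d x)
      c-ok : ∀ u v → u ∈ ⊤ → v ∈ ⊤ → Adj G u v → c u ≢ c v
      c-ok u v _ _ e with u ∈? S | v ∈? S
      ... | yes u∈S | yes v∈S = contradiction e (st u v u∈S v∈S)
      ... | yes _ | no _ = fromℕ≢inject₁
      ... | no _ | yes _ = λ eq → fromℕ≢inject₁ (sym eq)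
      ... | no u∉S | no v∉S with cover u | cover v
      ... | inj₂ u∈S | _ = contradiction u∈S u∉S
      ... | _ | inj₂ v∈S = contradiction v∈S v∉S
      ... | inj₁ u∈A | inj₁ v∈A = λ eq → d-ok u v u∈A v∈A e (inject₁-injective eq)

  module TopColourClass (c3 : ThreeColorable G) where
    c : Fin n → Fin 3
    c = proj₁ c3

    isTop : Fin n → Bool
    isTop x = does (c x ≟F top)

    S : Subset n
    S = tabulate isTop

    inS : ∀ {x} → x ∈ S → c x ≡ top
    inS {x} x∈S with c x ≟F top | trans (sym (lookup∘tabulate isTop x)) ([]=⇒lookup x∈S)
    ... | yes cx≡top | _ = cx≡top
    ... | no _ | ()

    notInS : ∀ {x} → x ∉ S → c x ≢ top
    notInS {x} x∉S cx≡top = x∉S (lookup⇒[]= x S (trans (lookup∘tabulate isTop x) (isTrue cx≡top)))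
      where
        isTrue : c x ≡ top → isTop x ≡ true
        isTrue eq with c x ≟F top
        ... | yes _ = refl
        ... | no ne = contradiction eq ne

    S-stable : Stable G S
    S-stable u v u∈S v∈S e = proj₂ c3 u v ∈⊤ ∈⊤ e (trans (inS u∈S) (sym (inS v∈S)))

    rest-bipartite : Colorable G (∁ S) 2
    rest-bipartite = (λ x → dropTop (c x)) , λ u v u∈ v∈ e eq →
      proj₂ c3 u v ∈⊤ ∈⊤ e
        (dropTop-injective (c u) (c v) (notInS (x∈∁p⇒x∉p u∈)) (notInS (x∈∁p⇒x∉p v∈)) eq)

module TriangleFreeFacts (G : Graph) (tf : TriangleFree G) where
  open Graph G using (n)
  open GraphFacts G

  cliqueBound : ∀ {Y j} → HasClique G Y j → j ≤ 2
  cliqueBound {j = zero} _ = z≤n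
  cliqueBound {j = suc zero} _ = s≤s z≤n
  cliqueBound {j = suc (suc zero)} _ = s≤s (s≤s z≤n)
  cliqueBound {j = suc (suc (suc j))} (f , _ , clique) =
    contradiction (clique fz (fs (fs fz)) λ ())
      (tf (f fz) (f (fs fz)) (f (fs (fs fz))) (clique fz (fs fz) λ ()) (clique (fs fz) (fs (fs fz)) λ ()))

  ω-edge : ∀ {Y} → Edge Y → CliqueNumber G Y 2
  ω-edge e = edgeClique e , λ _ → cliqueBound

  bipartite⇒perfect : ∀ {A} → Colorable G A 2 → Perfect G A
  bipartite⇒perfect c2 Y Y⊆A x with edgeOrStable Y
  ... | inj₁ e = 2 , (restrict c2 Y⊆A , λ _ → edgeNeedsTwoColours e) , ω-edge e
  ... | inj₂ st = 1 , (stableColorable st , λ _ → vertexNeedsColour x) , ω-stable x st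

  perfect⇒bipartite : ∀ {A} → Perfect G A → Colorable G A 2
  perfect⇒bipartite {A} perfect with nonempty? A
  ... | no A≡∅ = emptyColorable A≡∅
  ... | yes x with perfect A (λ x∈ → x∈) x
  ... | _ , (c , _) , (clique , _) = moreColours c (cliqueBound clique)

  3col⇒stablePerfect : ThreeColorable G → StablePerfect G
  3col⇒stablePerfect c3 = S , S-stable , bipartite⇒perfect rest-bipartite
    where open TopColourClass c3

  stablePerfect⇒3col : StablePerfect G → ThreeColorable G
  stablePerfect⇒3col (S , st , perfect) =
    stable+bipartite⇒3colourable S (∁ S) st (perfect⇒bipartite perfect) cover
    where
      cover : ∀ x → x ∈ ∁ S ⊎ x ∈ S
      cover x with x ∈? S
      ... | yes x∈S = inj₂ x∈S
      ... | no x∉S = inj₁ (x∉p⇒x∈∁p x∉S)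

  -- Split H along the top colour class when H has an edge (ω(H) = 2 while the
  -- class part is stable); otherwise H itself is perfect and B is empty.
  3col⇒perfectlyDivisible : ThreeColorable G → PerfectlyDivisible G
  3col⇒perfectlyDivisible c3 H x with edgeOrStable H
  ... | inj₁ e =
    let open TopColourClass c3
        H∩S-stable = λ u v u∈ v∈ → S-stable u v (proj₂ (x∈p∩q⁻ H S u∈)) (proj₂ (x∈p∩q⁻ H S v∈))
        wB , wB≤1 , ωB = ω-stable≤1 H∩S-stable
    in H ∩ ∁ S , H ∩ S , splitAlong H S ,
       bipartite⇒perfect (restrict rest-bipartite λ x∈ → proj₂ (x∈p∩q⁻ H (∁ S) x∈)) ,
       wB , 2 , ωB , ω-edge e , s≤s wB≤1
  ... | inj₂ st =
    H , ⊥ , wholePartition H , bipartite⇒perfect (moreColours (stableColorable st) (s≤s z≤n)) ,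
    0 , 1 , ω-empty (λ (_ , x∈⊥) → ∉⊥ x∈⊥) , ω-stable x st , s≤s z≤n

  -- Dividing V(G) gives a perfect A and a B with ω(B) < ω(G) ≤ 2, so B is stable.
  perfectlyDivisible⇒3col : PerfectlyDivisible G → ThreeColorable G
  perfectlyDivisible⇒3col pd with nonempty? {n} ⊤
  ... | no V≡∅ = emptyColorable V≡∅
  ... | yes x with pd ⊤ x
  ... | A , B , (_ , _ , cover , _) , perfectA , wB , wH , ωB , (cliqueH , _) , wB<wH =
    stable+bipartite⇒3colourable B A (ω≤1⇒stable ωB (s≤s⁻¹ (≤-trans wB<wH (cliqueBound cliqueH))))
      (perfect⇒bipartite perfectA) (λ y → cover y ∈⊤)

  3col⇒nice : ThreeColorable G → Nice G
  3col⇒nice c3 H x with edgeOrStable H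
  ... | inj₂ st =
    1 , 1 , (stableColorable st , λ _ → vertexNeedsColour x) , ω-stable x st , inj₁ refl
  ... | inj₁ e =
    let χ , χ≤3 , isχ = chromaticNumber (restrict c3 λ _ → ∈⊤)
    in χ , 2 , isχ , ω-edge e , twoOrThree (edgeNeedsTwoColours e (proj₁ isχ)) χ≤3

  nice⇒3col : Nice G → ThreeColorable G
  nice⇒3col nice with nonempty? {n} ⊤
  ... | no V≡∅ = emptyColorable V≡∅
  ... | yes x with nice ⊤ x
  ... | χ , ω , (colouring , _) , (clique , _) , χ≈ω =
    moreColours colouring (atMostOneMore χ≈ω (cliqueBound clique))

mainTheorem4 : (G : Graph) → TriangleFree G →
    (ThreeColorable G ⇔ PerfectlyDivisible G) ×
    (ThreeColorable G ⇔ StablePerfect G) ×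
    (ThreeColorable G ⇔ Nice G)
mainTheorem4 G tf =
  mk⇔ 3col⇒perfectlyDivisible perfectlyDivisible⇒3col ,
  mk⇔ 3col⇒stablePerfect stablePerfect⇒3col ,
  mk⇔ 3col⇒nice nice⇒3col
  where open TriangleFreeFacts G tf
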